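{- Let $\overrightarrow{G}$ and $(G,\sigma)$ be associates of each other, and let $\overrightarrow{H}$ and $(H,\tau)$ be associates of each other. Then a vertex map $f:V(G)\to V(H)$ is a pushable homomorphism of $\overrightarrow{G}$ to $\overrightarrow{H}$ if and only if $f$ is a switchable homomorphism of $(G,\sigma)$ to $(H,\tau)$.
   Context: All graphs are finite, simple and bipartite. A signed graph $(G,\sigma)$ is a graph $G$ with $\sigma:E(G)\to\{+,-\}$; the sign of a closed walk is the product of the signs of its edges (with repetition, $\pm=\pm1$). A switchable homomorphism $(G,\sigma)\to(H,\tau)$ is a vertex map $f$ such that $f(u)f(v)\in E(H)$ for every $uv\in E(G)$ and for every closed walk $C$ of $G$, $f(C)$ is a closed walk of $H$ with $\tau(f(C))=\sigma(C)$. An oriented graph has no loops and at most one arc between two vertices. To push a vertex means to reverse all arcs incident to it; pushing a set pushes each vertex once; push equivalent oriented graphs are obtained from each other by pushing a vertex set. A pushable homomorphism $\overrightarrow{G}\to\overrightarrow{H}$ is a vertex map that is an arc-preserving map (homomorphism) from some oriented graph push equivalent to $\overrightarrow{G}$ to $\overrightarrow{H}$. Associates: given a bipartite signed graph $(G,\sigma)$ and a bipartition $V(G)=A\cup B$ into independent sets, its associated oriented graph has the same vertices, each positive edge $uv$ ($u\in A,v\in B$) becomes the arc $uv$ and each negative edge becomes the arc $vu$. Given a bipartite oriented graph $\overrightarrow{G}$ and a bipartition $A\cup B$, its associated signed graph has the same vertices and underlying graph, with an edge positive if its arc goes from $A$ to $B$ and negative if it goes from $B$ to $A$. $\overrightarrow{G}$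 and $(G,\sigma)$ are associates of each other if one is an associated graph of the other (for some choice of bipartition). -}

module Defs where

open import Data.Nat using (ℕ)
open import Data.Fin using (Fin)
open import Data.Bool using (Bool; true; false; _∧_; _∨_; _xor_; not; if_then_else_)
open import Data.List using (List; []; _∷_; map)
open import Data.Product using (Σ; _×_; _,_)
open import Data.Unit using (⊤)
open import Relation.Binary.PropositionalEquality using (_≡_; _≢_; refl)

record OrientedGraph (n : ℕ) : Set where
  field
    arc      : Fin n → Fin n → Bool
    loopless : ∀ u → arc u u ≡ false
    oneArc   : ∀ u v → arc u v ≡ true → arc v u ≡ false
open OrientedGraph public

-- Signs and signed (simple) graphs on Fin n.
-- The signature is given on all pairs but only its values on edges matter.

data Sign : Set where
  pos neg : Sign

_·_ : Sign → Sign → Sign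
pos · s = s
neg · pos = neg
neg · neg = pos

record SignedGraph (n : ℕ) : Set where
  field
    adj       : Fin n → Fin n → Bool
    sign      : Fin n → Fin n → Sign
    noLoops   : ∀ u → adj u u ≡ false
    adj-sym   : ∀ u v → adj u v ≡ adj v u
    sign-sym  : ∀ u v → sign u v ≡ sign v u
open SignedGraph public

isPos : Sign → Bool
isPos pos = true
isPos neg = false

-- Walks.  A walk is a start vertex v together with the list of the
-- subsequent vertices  v → w₁ → … → w_k.

IsWalk : ∀ {n} → (Fin n → Fin n → Bool) → Fin n → List (Fin n) → Set
IsWalk E v []       = ⊤
IsWalk E v (w ∷ ws) = (E v w ≡ true) × IsWalk E w ws

endpoint : ∀ {n} → Fin n → List (Fin n) → Fin n
endpoint v []       = v
endpoint v (w ∷ ws) = endpoint w ws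

walkSign : ∀ {n} → (Fin n → Fin n → Sign) → Fin n → List (Fin n) → Sign
walkSign σ v []       = pos
walkSign σ v (w ∷ ws) = σ v w · walkSign σ w ws

IsClosedWalk : ∀ {n} → SignedGraph n → Fin n → List (Fin n) → Set
IsClosedWalk G v ws = IsWalk (adj G) v ws × (endpoint v ws ≡ v)

SwitchableHom : ∀ {n m} → SignedGraph n → SignedGraph m → (Fin n → Fin m) → Set
SwitchableHom {n} G H f =
  (∀ u v → adj G u v ≡ true → adj H (f u) (f v) ≡ true) ×
  (∀ (v : Fin n) (ws : List (Fin n)) → IsClosedWalk G v ws →
     walkSign (sign H) (f v) (map f ws) ≡ walkSign (sign G) v ws)

private
  xor-self : ∀ b → (b xor b) ≡ false
  xor-self true  = refl
  xor-self false = refl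

  xor-comm : ∀ a b → (a xor b) ≡ (b xor a)
  xor-comm true  true  = refl
  xor-comm true  false = refl
  xor-comm false true  = refl
  xor-comm false false = refl

pushArc : ∀ {n} → OrientedGraph n → (Fin n → Bool) → Fin n → Fin n → Bool
pushArc G S u v = if (S u xor S v) then arc G v u else arc G u v

private
  push-loopless : ∀ {n} (G : OrientedGraph n) S u → pushArc G S u u ≡ false
  push-loopless G S u with S u
  ... | true  = loopless G u
  ... | false = loopless G u

  push-oneArc : ∀ {n} (G : OrientedGraph n) S u v →
                pushArc G S u v ≡ true → pushArc G S v u ≡ false
  push-oneArc G S u v p with S u | S v
  ... | true  | true  = oneArc G u v p
  ... | true  | false = oneArc G v u p
  ... | false | true  = oneArc G v u p
  ... | false | false = oneArc G u v p

push : ∀ {n} → OrientedGraph n → (Fin n → Bool) → OrientedGraph n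
push G S = record
  { arc      = pushArc G S
  ; loopless = push-loopless G S
  ; oneArc   = push-oneArc G S
  }

OrientedHom : ∀ {n m} → OrientedGraph n → OrientedGraph m → (Fin n → Fin m) → Set
OrientedHom G H f = ∀ u v → arc G u v ≡ true → arc H (f u) (f v) ≡ true

PushableHom : ∀ {n m} → OrientedGraph n → OrientedGraph m → (Fin n → Fin m) → Set
PushableHom {n} G H f = Σ (Fin n → Bool) λ S → OrientedHom (push G S) H f

-- Bipartitions and associates.  A bipartition is a map part : Fin n → Bool
-- (A = part⁻¹ true, B = part⁻¹ false) such that A and B are independent.

IsBipartition : ∀ {n} → (Fin n → Fin n → Bool) → (Fin n → Bool) → Set
IsBipartition E part = ∀ u v → E u v ≡ true → part u ≢ part v

underlying : ∀ {n} → OrientedGraph n → Fin n → Fin n → Bool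
underlying G u v = arc G u v ∨ arc G v u

-- The oriented graph O and the signed graph S are associates w.r.t. the
-- bipartition part: same underlying graph, A,B independent, and for
-- u ∈ A, v ∈ B, the edge uv is positive iff it is the arc uv and negative
-- iff it is the arc vu.  (This relation is exactly "O is the associated
-- oriented graph of S" and equally "S is the associated signed graph of O".)
AssociatesWrt : ∀ {n} → OrientedGraph n → SignedGraph n → (Fin n → Bool) → Set
AssociatesWrt O S part =
  IsBipartition (adj S) part ×
  (∀ u v → adj S u v ≡ underlying O u v) ×
  (∀ u v → part u ≡ true → part v ≡ false →
     (arc O u v ≡ (adj S u v ∧ isPos (sign S u v))) ×
     (arc O v u ≡ (adj S u v ∧ not (isPos (sign S u v)))))

Associates : ∀ {n} → OrientedGraph n → SignedGraph n → Set
Associates {n} O S = Σ (Fin n → Bool) λ part → AssociatesWrt O S part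

{-# OPTIONS --safe #-}

-- On an edge uv of an associated pair, the arc points from u to v exactly when
-- [u ∈ A] ⊕ [uv negative].  Hence, for an edge-preserving f, f is a homomorphism
-- from G pushed at S exactly when, on every edge uv, the relative sign
-- σ(uv) τ(f u f v) is negative iff X = S ⊕ c separates u and v, where c marks the
-- vertices of A_G sent into B_H.  So f is pushable iff the relative signature is
-- switching equivalent to the all-positive one, which by Harary's theorem means
-- that every closed walk has the same sign in G as its image in H, i.e. f is
-- switchable.  For the converse of Harary's theorem, X is read off from the signs
-- of walks from each vertex to a common root of its component.

module Submission where

open import Defs
open import Data.Nat using (ℕ; zero; suc; _+_; _<_; _≤_; z≤n)
open import Data.Nat.Properties
  using (≤-refl; <⇒≤; ≤-antisym; ≮⇒≥; +-mono-≤; +-mono-<-≤; +-mono-≤-<; _<?_)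
open import Data.Nat.Induction using (<-wellFounded)
open import Induction.WellFounded using (Acc; acc)
open import Data.Fin using (Fin; toℕ; zero; suc)
open import Data.Fin.Properties using (any?; toℕ-injective) renaming (_≟_ to _≟ᶠ_)
open import Data.Bool using (Bool; true; false; _∧_; _∨_; _xor_; not; if_then_else_)
open import Data.Bool.Properties
  using (not-involutive; not-distribˡ-xor; not-distribʳ-xor; xor-comm; xor-same) renaming (_≟_ to _≟ᵇ_)
open import Data.Bool.Solver using (module xor-∧-Solver)
open import Data.List using (List; []; _∷_; map; _++_)
open import Data.Product using (Σ; ∃₂; _×_; _,_; proj₁; proj₂)
open import Data.Sum using (_⊎_; inj₁; inj₂)
open import Data.Unit using (tt)
open import Data.Empty using (⊥-elim)
open import Function using (_∘_)
open import Function.Bundles using (_⇔_; mk⇔; module Equivalence)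
open import Relation.Nullary using (yes; no)
open import Relation.Nullary.Decidable using (_×-dec_)
open import Relation.Binary.PropositionalEquality
open ≡-Reasoning

open Equivalence using (to; from)

module _ where
  open xor-∧-Solver

  xor-telescope : ∀ a b c → (a xor b) xor (b xor c) ≡ a xor c
  xor-telescope = solve 3 (λ a b c → (a :+ b) :+ (b :+ c) := a :+ c) refl

  xor-cancelʳ : ∀ a b → (a xor b) xor b ≡ a
  xor-cancelʳ = solve 2 (λ a b → (a :+ b) :+ b := a) refl

  xor-interchange : ∀ a b c d → (a xor b) xor (c xor d) ≡ (a xor c) xor (b xor d)
  xor-interchange = solve 4 (λ a b c d → (a :+ b) :+ (c :+ d) := (a :+ c) :+ (b :+ d)) refl

  xor-shuffle : ∀ p a b s t →
                (p xor (a xor s)) xor (b xor t) ≡ (s xor t) xor (p xor (a xor b))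
  xor-shuffle = solve 5 (λ p a b s t →
    (p :+ (a :+ s)) :+ (b :+ t) := (s :+ t) :+ (p :+ (a :+ b))) refl

xor≡false⇔≡ : ∀ x y → x xor y ≡ false ⇔ x ≡ y
xor≡false⇔≡ x y = mk⇔ (eq x y) (λ { refl → xor-same x })
  where
  eq : ∀ x y → x xor y ≡ false → x ≡ y
  eq false false _ = refl
  eq true  true  _ = refl

xor-transpose : ∀ {x y z w} p a b s t →
                x ≡ p xor (a xor s) → y ≡ b xor t →
                z ≡ s xor t → w ≡ p xor (a xor b) →
                x ≡ y ⇔ z ≡ w
xor-transpose {x} {y} {z} {w} p a b s t refl refl refl refl = mk⇔
  (λ x≡y → to (xor≡false⇔≡ z w)
             (trans (sym (xor-shuffle p a b s t)) (from (xor≡false⇔≡ x y) x≡y)))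
  (λ z≡w → to (xor≡false⇔≡ x y)
             (trans (xor-shuffle p a b s t) (from (xor≡false⇔≡ z w) z≡w)))

≡-by-cases : ∀ {x y} → (x ≡ true → y ≡ true) → (not x ≡ true → not y ≡ true) → x ≡ y
≡-by-cases {true}  {y}     x⇒y _   = sym (x⇒y refl)
≡-by-cases {false} {true}  _   ¬x⇒¬y with ¬x⇒¬y refl
... | ()
≡-by-cases {false} {false} _   _   = refl

if-not-xor : ∀ c x → (if c then not x else x) ≡ c xor x
if-not-xor true  x = refl
if-not-xor false x = refl

∧-not-xor : ∀ a b → (a ∧ not b) xor (not a ∧ not (not b)) ≡ a xor b
∧-not-xor true  true  = refl
∧-not-xor true  false = refl
∧-not-xor false true  = refl
∧-not-xor false false = refl

isNeg : Sign → Bool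
isNeg s = not (isPos s)

isNeg-· : ∀ s t → isNeg (s · t) ≡ isNeg s xor isNeg t
isNeg-· pos t   = refl
isNeg-· neg pos = refl
isNeg-· neg neg = refl

isNeg≡false⇒pos : ∀ {s} → isNeg s ≡ false → s ≡ pos
isNeg≡false⇒pos {pos} _ = refl

·-identityʳ : ∀ s → s · pos ≡ s
·-identityʳ pos = refl
·-identityʳ neg = refl

·-comm : ∀ s t → s · t ≡ t · s
·-comm pos pos = refl
·-comm pos neg = refl
·-comm neg pos = refl
·-comm neg neg = refl

·-assoc : ∀ s t u → (s · t) · u ≡ s · (t · u)
·-assoc pos t   u   = refl
·-assoc neg pos u   = refl
·-assoc neg neg pos = refl
·-assoc neg neg neg = refl

·-interchange : ∀ s t u w → (s · t) · (u · w) ≡ (s · u) · (t · w)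
·-interchange s t u w = begin
  (s · t) · (u · w)  ≡⟨ ·-assoc s t (u · w) ⟩
  s · (t · (u · w))  ≡⟨ cong (s ·_) (sym (·-assoc t u w)) ⟩
  s · ((t · u) · w)  ≡⟨ cong (λ r → s · (r · w)) (·-comm t u) ⟩
  s · ((u · t) · w)  ≡⟨ cong (s ·_) (·-assoc u t w) ⟩
  s · (u · (t · w))  ≡⟨ sym (·-assoc s u (t · w)) ⟩
  (s · u) · (t · w)  ∎

·≡pos⇔≡ : ∀ s t → s · t ≡ pos ⇔ s ≡ t
·≡pos⇔≡ s t = mk⇔ (eq s t) (λ { refl → inverse s })
  where
  eq : ∀ s t → s · t ≡ pos → s ≡ t
  eq pos pos _ = refl
  eq neg neg _ = refl

  inverse : ∀ s → s · s ≡ pos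
  inverse pos = refl
  inverse neg = refl

module _ {n} {E : Fin n → Fin n → Bool} where

  isWalk-++ : ∀ {v} ws {ws′} → IsWalk E v ws → IsWalk E (endpoint v ws) ws′ →
              IsWalk E v (ws ++ ws′)
  isWalk-++ []       _       w′ = w′
  isWalk-++ (x ∷ ws) (e , w) w′ = e , isWalk-++ ws w w′

endpoint-++ : ∀ {n} (v : Fin n) ws ws′ →
              endpoint v (ws ++ ws′) ≡ endpoint (endpoint v ws) ws′
endpoint-++ v []       ws′ = refl
endpoint-++ v (x ∷ ws) ws′ = endpoint-++ x ws ws′

walkSign-++ : ∀ {n} (κ : Fin n → Fin n → Sign) v ws ws′ →
              walkSign κ v (ws ++ ws′) ≡ walkSign κ v ws · walkSign κ (endpoint v ws) ws′
walkSign-++ κ v []       ws′ = refl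
walkSign-++ κ v (x ∷ ws) ws′ =
  trans (cong (κ v x ·_) (walkSign-++ κ x ws ws′)) (sym (·-assoc (κ v x) _ _))

walkSign-· : ∀ {n} (σ ρ : Fin n → Fin n → Sign) v ws →
             walkSign (λ a b → σ a b · ρ a b) v ws ≡ walkSign σ v ws · walkSign ρ v ws
walkSign-· σ ρ v []       = refl
walkSign-· σ ρ v (x ∷ ws) =
  trans (cong ((σ v x · ρ v x) ·_) (walkSign-· σ ρ x ws)) (·-interchange (σ v x) (ρ v x) _ _)

walkSign-map : ∀ {n m} (τ : Fin m → Fin m → Sign) (f : Fin n → Fin m) v ws →
               walkSign τ (f v) (map f ws) ≡ walkSign (λ a b → τ (f a) (f b)) v ws
walkSign-map τ f v []       = refl
walkSign-map τ f v (x ∷ ws) = cong (τ (f v) (f x) ·_) (walkSign-map τ f x ws)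

reverseWalk : ∀ {n} → Fin n → List (Fin n) → List (Fin n)
reverseWalk v []       = []
reverseWalk v (w ∷ ws) = reverseWalk w ws ++ v ∷ []

endpoint-reverseWalk : ∀ {n} (v : Fin n) ws → endpoint (endpoint v ws) (reverseWalk v ws) ≡ v
endpoint-reverseWalk v []       = refl
endpoint-reverseWalk v (w ∷ ws) = endpoint-++ (endpoint w ws) (reverseWalk w ws) (v ∷ [])

isWalk-reverseWalk : ∀ {n} {E : Fin n → Fin n → Bool} → (∀ u v → E u v ≡ E v u) →
                     ∀ v ws → IsWalk E v ws → IsWalk E (endpoint v ws) (reverseWalk v ws)
isWalk-reverseWalk Esym v []       _       = tt
isWalk-reverseWalk {E = E} Esym v (w ∷ ws) (e , walk) =
  isWalk-++ (reverseWalk w ws) (isWalk-reverseWalk Esym w ws walk)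
    (subst (λ z → E z v ≡ true) (sym (endpoint-reverseWalk w ws)) (trans (Esym w v) e) , tt)

walkSign-reverseWalk : ∀ {n} (κ : Fin n → Fin n → Sign) → (∀ u v → κ u v ≡ κ v u) →
                       ∀ v ws → walkSign κ (endpoint v ws) (reverseWalk v ws) ≡ walkSign κ v ws
walkSign-reverseWalk κ κsym v []       = refl
walkSign-reverseWalk κ κsym v (w ∷ ws) = begin
  walkSign κ (endpoint w ws) (reverseWalk w ws ++ v ∷ [])
    ≡⟨ walkSign-++ κ (endpoint w ws) (reverseWalk w ws) (v ∷ []) ⟩
  walkSign κ (endpoint w ws) (reverseWalk w ws) · (κ (endpoint (endpoint w ws) (reverseWalk w ws)) v · pos)
    ≡⟨ cong₂ (λ s z → s · (κ z v · pos)) (walkSign-reverseWalk κ κsym w ws) (endpoint-reverseWalk w ws) ⟩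
  walkSign κ w ws · (κ w v · pos)
    ≡⟨ cong (walkSign κ w ws ·_) (trans (·-identityʳ (κ w v)) (κsym w v)) ⟩
  walkSign κ w ws · κ v w
    ≡⟨ ·-comm (walkSign κ w ws) (κ v w) ⟩
  κ v w · walkSign κ w ws ∎

sumᶠ : ∀ {k} → (Fin k → ℕ) → ℕ
sumᶠ {zero}  g = 0
sumᶠ {suc k} g = g zero + sumᶠ (g ∘ suc)

sumᶠ-mono-≤ : ∀ {k} {g h : Fin k → ℕ} → (∀ x → g x ≤ h x) → sumᶠ g ≤ sumᶠ h
sumᶠ-mono-≤ {zero}  _   = z≤n
sumᶠ-mono-≤ {suc k} g≤h = +-mono-≤ (g≤h zero) (sumᶠ-mono-≤ (g≤h ∘ suc))

sumᶠ-mono-< : ∀ {k} {g h : Fin k → ℕ} → (∀ x → g x ≤ h x) → ∀ u → g u < h u → sumᶠ g < sumᶠ h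
sumᶠ-mono-< g≤h zero    lt = +-mono-<-≤ lt (sumᶠ-mono-≤ (g≤h ∘ suc))
sumᶠ-mono-< g≤h (suc u) lt = +-mono-≤-< (g≤h zero) (sumᶠ-mono-< (g≤h ∘ suc) u lt)

-- Redirecting a vertex through a neighbour with a smaller root strictly decreases
-- the total of the root indices, so repeated redirection ends in a rooting in which
-- adjacent vertices share their root.
module Components {n} (E : Fin n → Fin n → Bool) where

  Rooting : Set
  Rooting = (u : Fin n) → Σ (List (Fin n)) (IsWalk E u)

  root : Rooting → Fin n → Fin n
  root T u = endpoint u (proj₁ (T u))

  rank : Rooting → Fin n → ℕ
  rank T = toℕ ∘ root T

  Stable : Rooting → Set
  Stable T = ∀ u v → E u v ≡ true → rank T u ≤ rank T v

  redirect : Rooting → ∀ u v → E u v ≡ true → Rooting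
  redirect T u v e x with x ≟ᶠ u
  ... | yes refl = v ∷ proj₁ (T v) , e , proj₂ (T v)
  ... | no  _    = T x

  rank-redirect-≤ : ∀ T u v e → rank T v < rank T u → ∀ x → rank (redirect T u v e) x ≤ rank T x
  rank-redirect-≤ T u v e lt x with x ≟ᶠ u
  ... | yes refl = <⇒≤ lt
  ... | no  _    = ≤-refl

  rank-redirect-< : ∀ T u v e → rank T v < rank T u → rank (redirect T u v e) u < rank T u
  rank-redirect-< T u v e lt with u ≟ᶠ u
  ... | yes refl = lt
  ... | no  u≢u  = ⊥-elim (u≢u refl)

  weight : Rooting → ℕ
  weight T = sumᶠ (rank T)

  weight-redirect : ∀ T u v e → rank T v < rank T u → weight (redirect T u v e) < weight T
  weight-redirect T u v e lt =
    sumᶠ-mono-< (rank-redirect-≤ T u v e lt) u (rank-redirect-< T u v e lt)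

  unstableEdge? : ∀ T → (∃₂ λ u v → E u v ≡ true × rank T v < rank T u) ⊎ Stable T
  unstableEdge? T with any? (λ u → any? (λ v → (E u v ≟ᵇ true) ×-dec (rank T v <? rank T u)))
  ... | yes (u , v , e , lt) = inj₁ (u , v , e , lt)
  ... | no  none             = inj₂ (λ u v e → ≮⇒≥ (λ lt → none (u , v , e , lt)))

  stabilise : ∀ T → Acc _<_ (weight T) → Σ Rooting Stable
  stabilise T (acc rs) with unstableEdge? T
  ... | inj₂ stable           = T , stable
  ... | inj₁ (u , v , e , lt) = stabilise (redirect T u v e) (rs (weight-redirect T u v e lt))

  connectedRooting : (∀ u v → E u v ≡ E v u) →
                     Σ Rooting λ T → ∀ u v → E u v ≡ true → root T u ≡ root T v
  connectedRooting Esym with stabilise (λ u → [] , tt) (<-wellFounded _)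
  ... | T , stable = T , λ u v e →
    toℕ-injective (≤-antisym (stable u v e) (stable v u (trans (Esym v u) e)))

Balanced : ∀ {n} → (Fin n → Fin n → Bool) → (Fin n → Fin n → Sign) → Set
Balanced E κ = ∀ v ws → IsWalk E v ws × endpoint v ws ≡ v → walkSign κ v ws ≡ pos

SwitchesToPositive : ∀ {n} → (Fin n → Fin n → Bool) → (Fin n → Fin n → Sign) → (Fin n → Bool) → Set
SwitchesToPositive E κ X = ∀ u v → E u v ≡ true → isNeg (κ u v) ≡ X u xor X v

module _ {n} {E : Fin n → Fin n → Bool} {κ : Fin n → Fin n → Sign} where

  isNeg-walkSign : ∀ {X} → SwitchesToPositive E κ X →
                   ∀ v ws → IsWalk E v ws → isNeg (walkSign κ v ws) ≡ X v xor X (endpoint v ws)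
  isNeg-walkSign {X} switches v []       _          = sym (xor-same (X v))
  isNeg-walkSign {X} switches v (x ∷ ws) (e , walk) = begin
    isNeg (κ v x · walkSign κ x ws)                ≡⟨ isNeg-· (κ v x) _ ⟩
    isNeg (κ v x) xor isNeg (walkSign κ x ws)      ≡⟨ cong₂ _xor_ (switches v x e) (isNeg-walkSign {X} switches x ws walk) ⟩
    (X v xor X x) xor (X x xor X (endpoint x ws))  ≡⟨ xor-telescope (X v) (X x) _ ⟩
    X v xor X (endpoint x ws)                      ∎

  switchesToPositive⇒balanced : ∀ {X} → SwitchesToPositive E κ X → Balanced E κ
  switchesToPositive⇒balanced {X} switches v ws (walk , closed) = isNeg≡false⇒pos (begin
    isNeg (walkSign κ v ws)      ≡⟨ isNeg-walkSign {X} switches v ws walk ⟩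
    X v xor X (endpoint v ws)    ≡⟨ cong (λ z → X v xor X z) closed ⟩
    X v xor X v                  ≡⟨ xor-same (X v) ⟩
    false                        ∎)

  module _ (Esym : ∀ u v → E u v ≡ E v u) (κsym : ∀ u v → κ u v ≡ κ v u) (balanced : Balanced E κ) where

    -- The edge uv, the walk from v and the reversed walk from u close up at u.
    edgeSign-via-walks : ∀ {u v as bs} → IsWalk E u as → IsWalk E v bs →
                         endpoint u as ≡ endpoint v bs → E u v ≡ true →
                         κ u v ≡ walkSign κ v bs · walkSign κ u as
    edgeSign-via-walks {u} {v} {as} {bs} walkᵤ walkᵥ sameEnd e =
      to (·≡pos⇔≡ (κ u v) _) (trans (sym closedWalk-sign) closedWalk-positive)
      where
      back : List (Fin n)
      back = reverseWalk u as

      closedWalk-positive : walkSign κ u (v ∷ bs ++ back) ≡ pos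
      closedWalk-positive = balanced u (v ∷ bs ++ back)
        ( (e , isWalk-++ bs walkᵥ
                 (subst (λ r → IsWalk E r back) sameEnd (isWalk-reverseWalk Esym u as walkᵤ)))
        , trans (endpoint-++ v bs back)
            (trans (cong (λ r → endpoint r back) (sym sameEnd)) (endpoint-reverseWalk u as)))

      closedWalk-sign : walkSign κ u (v ∷ bs ++ back) ≡ κ u v · (walkSign κ v bs · walkSign κ u as)
      closedWalk-sign = begin
        κ u v · walkSign κ v (bs ++ back)              ≡⟨ cong (κ u v ·_) (walkSign-++ κ v bs back) ⟩
        κ u v · (walkSign κ v bs · walkSign κ (endpoint v bs) back)
          ≡⟨ cong (λ r → κ u v · (walkSign κ v bs · walkSign κ r back)) (sym sameEnd) ⟩
        κ u v · (walkSign κ v bs · walkSign κ (endpoint u as) back)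
          ≡⟨ cong (λ s → κ u v · (walkSign κ v bs · s)) (walkSign-reverseWalk κ κsym u as) ⟩
        κ u v · (walkSign κ v bs · walkSign κ u as)    ∎

    balanced⇒switchesToPositive : Σ (Fin n → Bool) (SwitchesToPositive E κ)
    balanced⇒switchesToPositive with Components.connectedRooting E Esym
    ... | T , sameRoot = X , switches
      where
      X : Fin n → Bool
      X u = isNeg (walkSign κ u (proj₁ (T u)))

      switches : SwitchesToPositive E κ X
      switches u v e = begin
        isNeg (κ u v)
          ≡⟨ cong isNeg (edgeSign-via-walks (proj₂ (T u)) (proj₂ (T v)) (sameRoot u v e) e) ⟩
        isNeg (walkSign κ v (proj₁ (T v)) · walkSign κ u (proj₁ (T u)))
          ≡⟨ isNeg-· (walkSign κ v (proj₁ (T v))) (walkSign κ u (proj₁ (T u))) ⟩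
        X v xor X u
          ≡⟨ xor-comm (X v) (X u) ⟩
        X u xor X v ∎

module Associated {n} (O : OrientedGraph n) (G : SignedGraph n) (part : Fin n → Bool)
                  (associated : AssociatesWrt O G part) where

  private
    bipartite   = proj₁ associated
    sameEdges   = proj₁ (proj₂ associated)
    orientation = proj₂ (proj₂ associated)

  part-opposite : ∀ {u v} → adj G u v ≡ true → part v ≡ not (part u)
  part-opposite {u} {v} e with part u | part v | bipartite u v e
  ... | true  | true  | p≢ = ⊥-elim (p≢ refl)
  ... | true  | false | _  = refl
  ... | false | true  | _  = refl
  ... | false | false | p≢ = ⊥-elim (p≢ refl)

  arc-on-edge : ∀ {u v} → adj G u v ≡ true → arc O u v ≡ part u xor isNeg (sign G u v)
  arc-on-edge {u} {v} e with part u in pu | part v in pv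
  ... | true  | true  = ⊥-elim (bipartite u v e (trans pu (sym pv)))
  ... | false | false = ⊥-elim (bipartite u v e (trans pu (sym pv)))
  ... | true  | false = begin
    arc O u v                        ≡⟨ proj₁ (orientation u v pu pv) ⟩
    adj G u v ∧ isPos (sign G u v)   ≡⟨ cong (_∧ isPos (sign G u v)) e ⟩
    isPos (sign G u v)               ≡⟨ sym (not-involutive _) ⟩
    not (isNeg (sign G u v))         ∎
  ... | false | true  = begin
    arc O u v                              ≡⟨ proj₂ (orientation v u pv pu) ⟩
    adj G v u ∧ not (isPos (sign G v u))   ≡⟨ cong₂ (λ a s → a ∧ isNeg s) (trans (adj-sym G v u) e) (sign-sym G v u) ⟩
    isNeg (sign G u v)                     ∎

  arc-reverse : ∀ {u v} → adj G u v ≡ true → arc O v u ≡ not (arc O u v)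
  arc-reverse {u} {v} e = begin
    arc O v u                                        ≡⟨ arc-on-edge (trans (adj-sym G v u) e) ⟩
    part v xor isNeg (sign G v u)                    ≡⟨ cong₂ (λ p s → p xor isNeg s) (part-opposite e) (sign-sym G v u) ⟩
    not (part u) xor isNeg (sign G u v)              ≡⟨ sym (not-distribˡ-xor (part u) _) ⟩
    not (part u xor isNeg (sign G u v))              ≡⟨ cong not (sym (arc-on-edge e)) ⟩
    not (arc O u v)                                  ∎

  adj-of-arc : ∀ {u v} → arc O u v ≡ true → adj G u v ≡ true
  adj-of-arc {u} {v} a = trans (sameEdges u v) (cong (_∨ arc O v u) a)

  adj-of-pushArc : ∀ S {u v} → pushArc O S u v ≡ true → adj G u v ≡ true
  adj-of-pushArc S {u} {v} a with S u xor S v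
  ... | true  = trans (adj-sym G u v) (adj-of-arc a)
  ... | false = adj-of-arc a

  pushArc-on-edge : ∀ S {u v} → adj G u v ≡ true → pushArc O S u v ≡ (S u xor S v) xor arc O u v
  pushArc-on-edge S {u} {v} e =
    trans (cong (if S u xor S v then_else arc O u v) (arc-reverse e)) (if-not-xor (S u xor S v) _)

  pushArc-reverse : ∀ S {u v} → adj G u v ≡ true → pushArc O S v u ≡ not (pushArc O S u v)
  pushArc-reverse S {u} {v} e = begin
    pushArc O S v u                     ≡⟨ pushArc-on-edge S (trans (adj-sym G v u) e) ⟩
    (S v xor S u) xor arc O v u         ≡⟨ cong₂ _xor_ (xor-comm (S v) (S u)) (arc-reverse e) ⟩
    (S u xor S v) xor not (arc O u v)   ≡⟨ sym (not-distribʳ-xor (S u xor S v) _) ⟩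
    not ((S u xor S v) xor arc O u v)   ≡⟨ cong not (sym (pushArc-on-edge S e)) ⟩
    not (pushArc O S u v)               ∎

relativeSign : ∀ {n m} → (Fin n → Fin n → Sign) → (Fin m → Fin m → Sign) →
               (Fin n → Fin m) → Fin n → Fin n → Sign
relativeSign σ τ f u v = σ u v · τ (f u) (f v)

relativeSign-sym : ∀ {n m} (G : SignedGraph n) (H : SignedGraph m) (f : Fin n → Fin m) →
                   ∀ u v → relativeSign (sign G) (sign H) f u v ≡ relativeSign (sign G) (sign H) f v u
relativeSign-sym G H f u v = cong₂ _·_ (sign-sym G u v) (sign-sym H (f u) (f v))

sameWalkSign⇔relativeSignPositive :
  ∀ {n m} (σ : Fin n → Fin n → Sign) (τ : Fin m → Fin m → Sign) (f : Fin n → Fin m) v ws →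
  walkSign (relativeSign σ τ f) v ws ≡ pos ⇔ walkSign τ (f v) (map f ws) ≡ walkSign σ v ws
sameWalkSign⇔relativeSignPositive σ τ f v ws = mk⇔
  (λ positive → trans (walkSign-map τ f v ws) (sym (to (·≡pos⇔≡ _ _) (trans (sym product) positive))))
  (λ same → trans product (from (·≡pos⇔≡ _ _) (sym (trans (sym (walkSign-map τ f v ws)) same))))
  where
  product : walkSign (relativeSign σ τ f) v ws ≡ walkSign σ v ws · walkSign (λ a b → τ (f a) (f b)) v ws
  product = walkSign-· σ (λ a b → τ (f a) (f b)) v ws

module Homomorphisms {n m} (Go : OrientedGraph n) (Gs : SignedGraph n) (pG : Fin n → Bool)
                     (Ho : OrientedGraph m) (Hs : SignedGraph m) (pH : Fin m → Bool)
                     (associatedG : AssociatesWrt Go Gs pG) (associatedH : AssociatesWrt Ho Hs pH)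
                     (f : Fin n → Fin m) where

  private
    module G = Associated Go Gs pG associatedG
    module H = Associated Ho Hs pH associatedH

  κ : Fin n → Fin n → Sign
  κ = relativeSign (sign Gs) (sign Hs) f

  -- The orientation convention of an edge flips between G and H exactly when f sends
  -- its end in A into the part B of H; pushing at these vertices corrects for this.
  crossing : Fin n → Bool
  crossing x = pG x ∧ not (pH (f x))

  EdgePreserving : Set
  EdgePreserving = ∀ u v → adj Gs u v ≡ true → adj Hs (f u) (f v) ≡ true

  crossing-on-edge : ∀ {u v} → adj Gs u v ≡ true → adj Hs (f u) (f v) ≡ true →
                     crossing u xor crossing v ≡ pG u xor pH (f u)
  crossing-on-edge {u} {v} e eH = begin
    crossing u xor (pG v ∧ not (pH (f v)))
      ≡⟨ cong₂ (λ a b → crossing u xor (a ∧ not b)) (G.part-opposite e) (H.part-opposite eH) ⟩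
    crossing u xor (not (pG u) ∧ not (not (pH (f u))))
      ≡⟨ ∧-not-xor (pG u) (pH (f u)) ⟩
    pG u xor pH (f u) ∎

  pushedHom⇒edgePreserving : ∀ S → OrientedHom (push Go S) Ho f → EdgePreserving
  pushedHom⇒edgePreserving S hom u v e with pushArc Go S u v in a
  ... | true  = H.adj-of-arc (hom u v a)
  ... | false = trans (adj-sym Hs (f u) (f v))
                      (H.adj-of-arc (hom v u (trans (G.pushArc-reverse S e) (cong not a))))

  pushedHom⇔orientationsAgree : EdgePreserving → ∀ S →
    OrientedHom (push Go S) Ho f ⇔ (∀ u v → adj Gs u v ≡ true → pushArc Go S u v ≡ arc Ho (f u) (f v))
  pushedHom⇔orientationsAgree preserving S = mk⇔
    (λ hom u v e → ≡-by-cases (hom u v) λ a →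
      trans (sym (H.arc-reverse (preserving u v e))) (hom v u (trans (G.pushArc-reverse S e) a)))
    (λ agree u v a → trans (sym (agree u v (G.adj-of-pushArc S a))) a)

  orientationsAgree⇔switching : ∀ S {u v} → adj Gs u v ≡ true → adj Hs (f u) (f v) ≡ true →
    pushArc Go S u v ≡ arc Ho (f u) (f v) ⇔ isNeg (κ u v) ≡ (S u xor crossing u) xor (S v xor crossing v)
  orientationsAgree⇔switching S {u} {v} e eH =
    xor-transpose (S u xor S v) (pG u) (pH (f u)) (isNeg (sign Gs u v)) (isNeg (sign Hs (f u) (f v)))
      (trans (G.pushArc-on-edge S e) (cong ((S u xor S v) xor_) (G.arc-on-edge e)))
      (H.arc-on-edge eH)
      (isNeg-· (sign Gs u v) (sign Hs (f u) (f v)))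
      (trans (xor-interchange (S u) (crossing u) (S v) (crossing v))
             (cong ((S u xor S v) xor_) (crossing-on-edge e eH)))

  pushedHom⇔switchesToPositive : EdgePreserving → ∀ S →
    OrientedHom (push Go S) Ho f ⇔ SwitchesToPositive (adj Gs) κ (λ x → S x xor crossing x)
  pushedHom⇔switchesToPositive preserving S = mk⇔
    (λ hom u v e → to (orientationsAgree⇔switching S e (preserving u v e))
                      (to (pushedHom⇔orientationsAgree preserving S) hom u v e))
    (λ switches → from (pushedHom⇔orientationsAgree preserving S) λ u v e →
                    from (orientationsAgree⇔switching S e (preserving u v e)) (switches u v e))

  pushableHom⇒switchableHom : PushableHom Go Ho f → SwitchableHom Gs Hs f
  pushableHom⇒switchableHom (S , hom) = preserving , λ v ws closed →
    to (sameWalkSign⇔relativeSignPositive (sign Gs) (sign Hs) f v ws)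
       (switchesToPositive⇒balanced {X = λ x → S x xor crossing x}
          (to (pushedHom⇔switchesToPositive preserving S) hom) v ws closed)
    where
    preserving : EdgePreserving
    preserving = pushedHom⇒edgePreserving S hom

  switchableHom⇒pushableHom : SwitchableHom Gs Hs f → PushableHom Go Ho f
  switchableHom⇒pushableHom (preserving , sameSign) =
    S , from (pushedHom⇔switchesToPositive preserving S) switches
    where
    balanced : Balanced (adj Gs) κ
    balanced v ws closed =
      from (sameWalkSign⇔relativeSignPositive (sign Gs) (sign Hs) f v ws) (sameSign v ws closed)

    switching : Σ (Fin n → Bool) (SwitchesToPositive (adj Gs) κ)
    switching = balanced⇒switchesToPositive (adj-sym Gs) (relativeSign-sym Gs Hs f) balanced

    X : Fin n → Bool
    X = proj₁ switching

    S : Fin n → Bool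
    S x = X x xor crossing x

    switches : SwitchesToPositive (adj Gs) κ (λ x → S x xor crossing x)
    switches u v e = trans (proj₂ switching u v e)
      (sym (cong₂ _xor_ (xor-cancelʳ (X u) (crossing u)) (xor-cancelʳ (X v) (crossing v))))

mainTheorem4 : ∀ {n m} (Go : OrientedGraph n) (Gs : SignedGraph n)
               (Ho : OrientedGraph m) (Hs : SignedGraph m) →
               Associates Go Gs → Associates Ho Hs →
               (f : Fin n → Fin m) →
               PushableHom Go Ho f ⇔ SwitchableHom Gs Hs f
mainTheorem4 Go Gs Ho Hs (pG , associatedG) (pH , associatedH) f =
  mk⇔ pushableHom⇒switchableHom switchableHom⇒pushableHom
  where open Homomorphisms Go Gs pG Ho Hs pH associatedG associatedH f
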